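{- Let $R$ be a right fountain triangulation of $\mathbb{N}$ with fountain point $0$, let $(m_{a,b})$ be the right half-frieze from $R$, and define $x^R_n=1$ if $m_{0,n+1}=1$ and $x^R_n=0$ otherwise ($n\ge1$). Then $x^R=\boldsymbol{x}^R$.
   Context: Arcs are pairs $(a,b)$ of integers with $0\le a<b$; arcs $(a,b),(c,d)$ cross if $a<c<b<d$ or $c<a<d<b$. A triangulation of $\mathbb{N}$ is a maximal set of pairwise noncrossing arcs. A right fountain triangulation with fountain point $0$ is such a triangulation containing $(0,n)$ for infinitely many $n$. $\boldsymbol{x}^R_n=1$ if $(0,n+1)\in R$ and $0$ otherwise. A right half-frieze (at $0$) is an array of positive integers $m_{a,b}$, $0\le a<b$, with $m_{a,a}=0$, $m_{a,a+1}=1$ and $m_{a,b}m_{a+1,b+1}-m_{a+1,b}m_{a,b+1}=1$ for all $0\le a<b$; it is determined by its quiddity sequence $(m_{a,a+2})_{a\ge0}$. The right half-frieze from $R$ has quiddity $m_{a,a+2}=$ the number of triangles of $R$ having $a+1$ as a vertex. -}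

module Defs where

open import Data.Nat using (ℕ; zero; suc; _+_; _*_; _<_; _≤_)
open import Data.Bool using (Bool; true; false)
open import Data.Product using (_×_; _,_; Σ; ∃; ∃-syntax)
open import Data.Sum using (_⊎_)
open import Data.List using (List; length)
open import Data.List.Membership.Propositional using (_∈_)
open import Data.List.Relation.Unary.Unique.Propositional using (Unique)
open import Relation.Binary.PropositionalEquality using (_≡_)
open import Relation.Nullary using (¬_)

ArcSet : Set
ArcSet = ℕ → ℕ → Bool

_∈R_ : ℕ × ℕ → ArcSet → Set
(a , b) ∈R R = R a b ≡ true

Cross : ℕ → ℕ → ℕ → ℕ → Set
Cross a b c d = (a < c × c < b × b < d) ⊎ (c < a × a < d × d < b)

record IsTriangulation (R : ArcSet) : Set where
  field
    arcs        : ∀ a b → (a , b) ∈R R → a < b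
    noncrossing : ∀ a b c d → (a , b) ∈R R → (c , d) ∈R R → ¬ Cross a b c d
    maximal     : ∀ a b → a < b →
                  (∀ c d → (c , d) ∈R R → ¬ Cross a b c d) → (a , b) ∈R R

record IsRightFountain0 (R : ArcSet) : Set where
  field
    triangulation : IsTriangulation R
    fountain      : ∀ N → ∃[ n ] (N ≤ n × (0 , n) ∈R R)

Triangle : ArcSet → ℕ × ℕ × ℕ → Set
Triangle R (i , j , k) = i < j × j < k × (i , j) ∈R R × (j , k) ∈R R × (i , k) ∈R R

HasVertex : ℕ → ℕ × ℕ × ℕ → Set
HasVertex v (i , j , k) = (v ≡ i) ⊎ (v ≡ j) ⊎ (v ≡ k)

-- "q is the number of triangles of R having v as a vertex":
-- there is a duplicate-free list enumerating exactly those triangles, of length q.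
TriangleCount : ArcSet → ℕ → ℕ → Set
TriangleCount R v q =
  Σ (List (ℕ × ℕ × ℕ)) λ l →
    Unique l × length l ≡ q ×
    (∀ t → t ∈ l → Triangle R t × HasVertex v t) ×
    (∀ t → Triangle R t → HasVertex v t → t ∈ l)

-- a right half-frieze (at 0): entries m a b for 0 ≤ a ≤ b (other entries ignored)
record IsRightHalfFrieze (m : ℕ → ℕ → ℕ) : Set where
  field
    positive : ∀ a b → a < b → 1 ≤ m a b
    diag0    : ∀ a → m a a ≡ 0
    diag1    : ∀ a → m a (suc a) ≡ 1
    unimod   : ∀ a b → a < b →
               m a b * m (suc a) (suc b) ≡ m (suc a) b * m a (suc b) + 1

record IsHalfFriezeFrom (R : ArcSet) (m : ℕ → ℕ → ℕ) : Set where
  field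
    frieze   : IsRightHalfFrieze m
    quiddity : ∀ a → TriangleCount R (suc a) (m a (suc (suc a)))

xArc : ArcSet → ℕ → ℕ
xArc R n with R 0 (suc n)
... | true  = 1
... | false = 0

xFrieze : (ℕ → ℕ → ℕ) → ℕ → ℕ
xFrieze m n with m 0 (suc n)
... | 1 = 1
... | _ = 0

-- Rows of a frieze solve the three-term recurrence  m a (t+2) + m a t = q t · m a (t+1)  whose
-- coefficients q t = m t (t+2) are the quiddity; hence the Wronskian of two rows is constant and
-- Ptolemy's relation  m a c · m b d = m a b · m c d + m a d · m b c  (a ≤ b ≤ c ≤ d) holds.
--
-- Arcs carry the entry 1, by induction on their length together with the sizes of the two fans of
-- triangles under an arc (y , x): the fan at x has size m y (x-1), the fan at y has size m (y+1) x.
-- Splitting (y , x) at the apex u of its triangle, the triangles at u are the fan at u under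
-- (y , u), the triangle (y , u , x) and the fan at u under (u , x); the recurrence at u and
-- Ptolemy's relation then give m y x = 1 and the two fan sizes for (y , x).
--
-- Conversely, if m a b = 1 but (a , b) is no arc, maximality yields an arc crossing it, and
-- Ptolemy's relation on the four endpoints makes the product of the two diagonal entries exceed 1.

{-# OPTIONS --safe #-}
module Submission where

open import Defs
open import Data.Nat using (ℕ; zero; suc; pred; _+_; _*_; _≤_; _<_; z≤n; s≤s; z<s; NonZero; >-nonZero; _≤′_; ≤′-refl; ≤′-step; _≤‴_; ≤‴-refl; ≤‴-step)
open import Data.Nat.Properties
open import Data.Bool using (Bool; true; false)
open import Data.Empty using (⊥)
open import Data.Product using (_×_; _,_; proj₁; Σ-syntax; ∃-syntax)
open import Data.Sum using (inj₁; inj₂)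
open import Data.List using (List; []; _∷_; _++_; length)
open import Data.List.Properties using (length-++)
open import Data.List.Membership.Propositional using (_∈_)
open import Data.List.Membership.Propositional.Properties using (∈-∃++; ∈-++⁻; ∈-++⁺ˡ; ∈-++⁺ʳ)
open import Data.List.Relation.Binary.Subset.Propositional using (_⊆_)
open import Data.List.Relation.Unary.All as All using ()
open import Data.List.Relation.Unary.Any using (here; there)
open import Data.List.Relation.Unary.AllPairs using ([]; _∷_)
open import Data.List.Relation.Unary.Unique.Propositional using (Unique)
import Data.List.Relation.Unary.Unique.Propositional.Properties as Unique
open import Function using (_∘_)
open import Level using (0ℓ)
open import Relation.Binary.PropositionalEquality
open import Relation.Binary.Definitions using (tri<; tri≈; tri>)
open import Relation.Nullary using (¬_; contradiction; yes; no)
open import Relation.Unary using (Pred; _∪_; ｛_｝; _≐_)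
open import Relation.Unary.Properties using (≐-sym)
open import Algebra.Properties.CommutativeSemigroup +-commutativeSemigroup
  using () renaming (interchange to +-interchange; x∙yz≈yx∙z to x+[y+z]≡[y+x]+z)
open import Algebra.Properties.CommutativeSemigroup *-commutativeSemigroup
  using () renaming (x∙yz≈y∙xz to x*[y*z]≡y*[x*z]; x∙yz≈yx∙z to x*[y*z]≡[y*x]*z)

module Recurrence (q : ℕ → ℕ) where

  record SolvesAt (f : ℕ → ℕ) (t : ℕ) : Set where
    constructor solves
    field recurrence : f (2 + t) + f t ≡ q t * f (1 + t)

  Solution : (ℕ → ℕ) → ℕ → Set
  Solution f s = ∀ {t} → s ≤ t → SolvesAt f t

  -- The Wronskian f t · g (1 + t) − f (1 + t) · g t equals K, stated additively to avoid truncated subtraction.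
  record Wronskian (K : ℕ) (f g : ℕ → ℕ) (t : ℕ) : Set where
    constructor wronskian
    field value : f t * g (1 + t) ≡ K + f (1 + t) * g t

  open ≡-Reasoning

  solvesAt-*ˡ : ∀ {f t} c → SolvesAt f t → SolvesAt (λ d → c * f d) t
  solvesAt-*ˡ {f} {t} c (solves sol) = solves (begin
    c * f (2 + t) + c * f t  ≡⟨ *-distribˡ-+ c (f (2 + t)) (f t) ⟨
    c * (f (2 + t) + f t)    ≡⟨ cong (c *_) sol ⟩
    c * (q t * f (1 + t))    ≡⟨ x*[y*z]≡y*[x*z] c (q t) (f (1 + t)) ⟩
    q t * (c * f (1 + t))    ∎)

  solvesAt-*ʳ : ∀ {f t} c → SolvesAt f t → SolvesAt (λ d → f d * c) t
  solvesAt-*ʳ {f} {t} c (solves sol) = solves (begin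
    f (2 + t) * c + f t * c  ≡⟨ *-distribʳ-+ c (f (2 + t)) (f t) ⟨
    (f (2 + t) + f t) * c    ≡⟨ cong (_* c) sol ⟩
    q t * f (1 + t) * c      ≡⟨ *-assoc (q t) (f (1 + t)) c ⟩
    q t * (f (1 + t) * c)    ∎)

  solvesAt-+ : ∀ {f g t} → SolvesAt f t → SolvesAt g t → SolvesAt (λ d → f d + g d) t
  solvesAt-+ {f} {g} {t} (solves solf) (solves solg) = solves (begin
    (f (2 + t) + g (2 + t)) + (f t + g t)  ≡⟨ +-interchange (f (2 + t)) (g (2 + t)) (f t) (g t) ⟩
    (f (2 + t) + f t) + (g (2 + t) + g t)  ≡⟨ cong₂ _+_ solf solg ⟩
    q t * f (1 + t) + q t * g (1 + t)      ≡⟨ *-distribˡ-+ (q t) (f (1 + t)) (g (1 + t)) ⟨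
    q t * (f (1 + t) + g (1 + t))          ∎)

  solution-unique : ∀ {f g s} → Solution f s → Solution g s →
                    f s ≡ g s → f (1 + s) ≡ g (1 + s) → ∀ {d} → s ≤ d → f d ≡ g d
  solution-unique {f} {g} {s} solf solg e₀ e₁ s≤d = proj₁ (agree (≤⇒≤′ s≤d))
    where
    agree : ∀ {d} → s ≤′ d → f d ≡ g d × f (1 + d) ≡ g (1 + d)
    agree ≤′-refl = e₀ , e₁
    agree (≤′-step {d} s≤′d) with agree s≤′d | solf (≤′⇒≤ s≤′d) | solg (≤′⇒≤ s≤′d)
    ... | eᵈ , eᵈ⁺¹ | solves solfᵈ | solves solgᵈ = eᵈ⁺¹ , +-cancelʳ-≡ (f d) (f (2 + d)) (g (2 + d)) (begin
      f (2 + d) + f d  ≡⟨ solfᵈ ⟩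
      q d * f (1 + d)  ≡⟨ cong (q d *_) eᵈ⁺¹ ⟩
      q d * g (1 + d)  ≡⟨ solgᵈ ⟨
      g (2 + d) + g d  ≡⟨ cong (g (2 + d) +_) eᵈ ⟨
      g (2 + d) + f d  ∎)

  wronskian-shift : ∀ {K f g t} → Wronskian K f g t →
                    (f (2 + t) + f t) * g (1 + t) ≡ K + f (2 + t) * g (1 + t) + f (1 + t) * g t
  wronskian-shift {K} {f} {g} {t} (wronskian w) = begin
    (f (2 + t) + f t) * g (1 + t)                  ≡⟨ *-distribʳ-+ (g (1 + t)) (f (2 + t)) (f t) ⟩
    f (2 + t) * g (1 + t) + f t * g (1 + t)        ≡⟨ cong (f (2 + t) * g (1 + t) +_) w ⟩
    f (2 + t) * g (1 + t) + (K + f (1 + t) * g t)  ≡⟨ x+[y+z]≡[y+x]+z (f (2 + t) * g (1 + t)) K _ ⟩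
    K + f (2 + t) * g (1 + t) + f (1 + t) * g t    ∎

  solvesAt-scaled : ∀ {g t} → SolvesAt g t → ∀ c →
                    c * (g (2 + t) + g t) ≡ q t * c * g (1 + t)
  solvesAt-scaled {g} {t} (solves solg) c = begin
    c * (g (2 + t) + g t)  ≡⟨ cong (c *_) solg ⟩
    c * (q t * g (1 + t))  ≡⟨ x*[y*z]≡[y*x]*z c (q t) (g (1 + t)) ⟩
    q t * c * g (1 + t)    ∎

  solvesAt-from-wronskian : ∀ {K f g t} → SolvesAt g t → .{{NonZero (g (1 + t))}} →
                            Wronskian K f g t → Wronskian K f g (1 + t) → SolvesAt f t
  solvesAt-from-wronskian {K} {f} {g} {t} solg w₀ (wronskian w₁) = solves (*-cancelʳ-≡ _ _ (g (1 + t)) (begin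
    (f (2 + t) + f t) * g (1 + t)                ≡⟨ wronskian-shift w₀ ⟩
    K + f (2 + t) * g (1 + t) + f (1 + t) * g t  ≡⟨ cong (_+ f (1 + t) * g t) w₁ ⟨
    f (1 + t) * g (2 + t) + f (1 + t) * g t      ≡⟨ *-distribˡ-+ (f (1 + t)) (g (2 + t)) (g t) ⟨
    f (1 + t) * (g (2 + t) + g t)                ≡⟨ solvesAt-scaled solg (f (1 + t)) ⟩
    q t * f (1 + t) * g (1 + t)                  ∎))

  wronskian-step : ∀ {K f g t} → SolvesAt f t → SolvesAt g t →
                   Wronskian K f g t → Wronskian K f g (1 + t)
  wronskian-step {K} {f} {g} {t} (solves solf) solg w = wronskian (+-cancelʳ-≡ (f (1 + t) * g t) _ _ (begin
    f (1 + t) * g (2 + t) + f (1 + t) * g t      ≡⟨ *-distribˡ-+ (f (1 + t)) (g (2 + t)) (g t) ⟨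
    f (1 + t) * (g (2 + t) + g t)                ≡⟨ solvesAt-scaled solg (f (1 + t)) ⟩
    q t * f (1 + t) * g (1 + t)                  ≡⟨ cong (_* g (1 + t)) solf ⟨
    (f (2 + t) + f t) * g (1 + t)                ≡⟨ wronskian-shift w ⟩
    K + f (2 + t) * g (1 + t) + f (1 + t) * g t  ∎))

  wronskian-invariant : ∀ {K f g s} → Solution f s → Solution g s →
                        Wronskian K f g s → ∀ {t} → s ≤ t → Wronskian K f g t
  wronskian-invariant {K} {f} {g} {s} solf solg w s≤t = go (≤⇒≤′ s≤t)
    where
    go : ∀ {t} → s ≤′ t → Wronskian K f g t
    go ≤′-refl        = w
    go (≤′-step s≤′t) = wronskian-step (solf (≤′⇒≤ s≤′t)) (solg (≤′⇒≤ s≤′t)) (go s≤′t)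

module Frieze {m : ℕ → ℕ → ℕ} (F : IsRightHalfFrieze m) where
  open IsRightHalfFrieze F
  open Recurrence (λ t → m t (2 + t))
  open ≡-Reasoning

  adjacent-rows-wronskian : ∀ {a b} → a < b → Wronskian 1 (m a) (m (suc a)) b
  adjacent-rows-wronskian {a} {b} a<b = wronskian (begin
    m a b * m (suc a) (suc b)      ≡⟨ unimod a b a<b ⟩
    m (suc a) b * m a (suc b) + 1  ≡⟨ +-comm _ 1 ⟩
    1 + m (suc a) b * m a (suc b)  ≡⟨ cong (1 +_) (*-comm (m (suc a) b) (m a (suc b))) ⟩
    1 + m a (suc b) * m (suc a) b  ∎)

  row-solution : ∀ {a t} → a ≤ t → SolvesAt (m a) t
  row-solution a≤t = go (≤⇒≤‴ a≤t)
    where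
    go : ∀ {a t} → a ≤‴ t → SolvesAt (m a) t
    go {t = t} ≤‴-refl = solves (begin
      m t (2 + t) + m t t        ≡⟨ cong (m t (2 + t) +_) (diag0 t) ⟩
      m t (2 + t) + 0            ≡⟨ +-identityʳ _ ⟩
      m t (2 + t)                ≡⟨ *-identityʳ _ ⟨
      m t (2 + t) * 1            ≡⟨ cong (m t (2 + t) *_) (diag1 t) ⟨
      m t (2 + t) * m t (1 + t)  ∎)
    go {a} {t} (≤‴-step sa≤‴t) =
      solvesAt-from-wronskian (go sa≤‴t) {{>-nonZero (positive (suc a) (suc t) (s≤s a<t))}}
        (adjacent-rows-wronskian a<t) (adjacent-rows-wronskian (m≤n⇒m≤1+n a<t))
      where a<t = ≤‴⇒≤ sa≤‴t

  wronskian-rows : ∀ {a b c} → a ≤ b → b ≤ c → Wronskian (m a b) (m a) (m b) c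
  wronskian-rows {a} {b} a≤b = wronskian-invariant (row-solution ∘ ≤-trans a≤b) row-solution (wronskian base)
    where
    base : m a b * m b (suc b) ≡ m a b + m a (suc b) * m b b
    base rewrite diag1 b | diag0 b | *-zeroʳ (m a (suc b)) = trans (*-identityʳ _) (sym (+-identityʳ _))

  ptolemy : ∀ {a b c d} → a ≤ b → b ≤ c → c ≤ d →
            m a c * m b d ≡ m a b * m c d + m a d * m b c
  ptolemy {a} {b} {c} a≤b b≤c =
    solution-unique (solvesAt-*ˡ (m a c) ∘ row-solution ∘ ≤-trans b≤c)
                    (λ c≤t → solvesAt-+ (solvesAt-*ˡ (m a b) (row-solution c≤t))
                                        (solvesAt-*ʳ (m b c) (row-solution (≤-trans (≤-trans a≤b b≤c) c≤t))))
                    at-c at-1+c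
    where
    at-c : m a c * m b c ≡ m a b * m c c + m a c * m b c
    at-c rewrite diag0 c | *-zeroʳ (m a b) = refl
    at-1+c : m a c * m b (suc c) ≡ m a b * m c (suc c) + m a (suc c) * m b c
    at-1+c rewrite diag1 c | *-identityʳ (m a b) = Wronskian.value (wronskian-rows a≤b b≤c)

  row-recurrence : ∀ {a t} → a ≤ t → m a (2 + t) + m a t ≡ m t (2 + t) * m a (1 + t)
  row-recurrence = SolvesAt.recurrence ∘ row-solution

  ptolemy-ac : ∀ {a b c d} → a ≤ b → b ≤ c → c ≤ d → m a b ≡ 1 → m b d ≡ 1 →
               m a c ≡ m c d + m a d * m b c
  ptolemy-ac {a} {b} {c} {d} a≤b b≤c c≤d ab bd = begin
    m a c                          ≡⟨ *-identityʳ (m a c) ⟨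
    m a c * 1                      ≡⟨ cong (m a c *_) bd ⟨
    m a c * m b d                  ≡⟨ ptolemy a≤b b≤c c≤d ⟩
    m a b * m c d + m a d * m b c  ≡⟨ cong (λ e → e * m c d + m a d * m b c) ab ⟩
    1 * m c d + m a d * m b c      ≡⟨ cong (_+ m a d * m b c) (*-identityˡ (m c d)) ⟩
    m c d + m a d * m b c          ∎

  ptolemy-bd : ∀ {a b c d} → a ≤ b → b ≤ c → c ≤ d → m a c ≡ 1 → m c d ≡ 1 →
               m b d ≡ m a b + m a d * m b c
  ptolemy-bd {a} {b} {c} {d} a≤b b≤c c≤d ac cd = begin
    m b d                          ≡⟨ *-identityˡ (m b d) ⟨
    1 * m b d                      ≡⟨ cong (_* m b d) ac ⟨
    m a c * m b d                  ≡⟨ ptolemy a≤b b≤c c≤d ⟩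
    m a b * m c d + m a d * m b c  ≡⟨ cong (λ e → m a b * e + m a d * m b c) cd ⟩
    m a b * 1 + m a d * m b c      ≡⟨ cong (_+ m a d * m b c) (*-identityʳ (m a b)) ⟩
    m a b + m a d * m b c          ∎

  crossing-diagonals : ∀ {a b c d} → a < b → b < c → c < d → 1 < m a c * m b d
  crossing-diagonals {a} {b} {c} {d} a<b b<c c<d =
    subst (1 <_) (sym (ptolemy (<⇒≤ a<b) (<⇒≤ b<c) (<⇒≤ c<d)))
      (+-mono-≤ (*-mono-≤ (positive a b a<b) (positive c d c<d))
                (*-mono-≤ (positive a d (<-trans a<b (<-trans b<c c<d))) (positive b c b<c)))

module _ {A : Set} where

  length-mono-⊆ : ∀ {xs ys : List A} → Unique xs → xs ⊆ ys → length xs ≤ length ys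
  length-mono-⊆ [] _ = z≤n
  length-mono-⊆ {x ∷ xs} (x∉xs ∷ uxs) x∷xs⊆ys with ∈-∃++ (x∷xs⊆ys (here refl))
  ... | as , bs , refl = begin
    suc (length xs)              ≤⟨ s≤s (length-mono-⊆ uxs xs⊆as++bs) ⟩
    suc (length (as ++ bs))      ≡⟨ cong suc (length-++ as) ⟩
    suc (length as + length bs)  ≡⟨ +-suc (length as) (length bs) ⟨
    length as + length (x ∷ bs)  ≡⟨ length-++ as ⟨
    length (as ++ x ∷ bs)        ∎
    where
    open ≤-Reasoning
    xs⊆as++bs : xs ⊆ as ++ bs
    xs⊆as++bs {v} v∈xs with ∈-++⁻ as (x∷xs⊆ys (there v∈xs))
    ... | inj₁ v∈as         = ∈-++⁺ˡ v∈as
    ... | inj₂ (here refl)  = contradiction refl (All.lookup x∉xs v∈xs)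
    ... | inj₂ (there v∈bs) = ∈-++⁺ʳ as v∈bs

  HasSize : Pred A 0ℓ → ℕ → Set
  HasSize P n = Σ[ xs ∈ List A ] Unique xs × length xs ≡ n × (∀ {x} → x ∈ xs → P x) × (∀ {x} → P x → x ∈ xs)

  hasSize-unique : ∀ {P n k} → HasSize P n → HasSize P k → n ≡ k
  hasSize-unique (xs , uxs , refl , xs⊆P , P⊆xs) (ys , uys , refl , ys⊆P , P⊆ys) =
    ≤-antisym (length-mono-⊆ uxs (P⊆ys ∘ xs⊆P)) (length-mono-⊆ uys (P⊆xs ∘ ys⊆P))

  hasSize-resp-≐ : ∀ {P Q n} → P ≐ Q → HasSize P n → HasSize Q n
  hasSize-resp-≐ (P⊆Q , Q⊆P) (xs , uxs , len , xs⊆P , P⊆xs) = xs , uxs , len , P⊆Q ∘ xs⊆P , P⊆xs ∘ Q⊆P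

  hasSize-empty : ∀ {P} → (∀ {x} → ¬ P x) → HasSize P 0
  hasSize-empty ¬P = [] , [] , refl , (λ ()) , λ Px → contradiction Px ¬P

  hasSize-singleton : ∀ x → HasSize ｛ x ｝ 1
  hasSize-singleton x = x ∷ [] , (All.[] ∷ []) , refl , (λ { (here refl) → refl }) , λ { refl → here refl }

  hasSize-∪ : ∀ {P Q n k} → (∀ {x} → P x → ¬ Q x) → HasSize P n → HasSize Q k → HasSize (P ∪ Q) (n + k)
  hasSize-∪ {P} {Q} P⊥Q (xs , uxs , refl , xs⊆P , P⊆xs) (ys , uys , refl , ys⊆Q , Q⊆ys) =
    xs ++ ys , Unique.++⁺ uxs uys xs⊥ys , length-++ xs , sound , complete
    where
    xs⊥ys : ∀ {x} → ¬ (x ∈ xs × x ∈ ys)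
    xs⊥ys (x∈xs , x∈ys) = P⊥Q (xs⊆P x∈xs) (ys⊆Q x∈ys)
    sound : ∀ {x} → x ∈ xs ++ ys → (P ∪ Q) x
    sound x∈ with ∈-++⁻ xs x∈
    ... | inj₁ x∈xs = inj₁ (xs⊆P x∈xs)
    ... | inj₂ x∈ys = inj₂ (ys⊆Q x∈ys)
    complete : ∀ {x} → (P ∪ Q) x → x ∈ xs ++ ys
    complete (inj₁ Px) = ∈-++⁺ˡ (P⊆xs Px)
    complete (inj₂ Qx) = ∈-++⁺ʳ xs (Q⊆ys Qx)

greatest-below : (P : ℕ → Bool) → ∀ {lo} x → lo < x → P lo ≡ true →
                 ∃[ u ] (lo ≤ u × u < x × P u ≡ true × (∀ {w} → u < w → w < x → P w ≡ false))
greatest-below P (suc x) lo<1+x Plo with P x in Px | m<1+n⇒m<n∨m≡n lo<1+x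
... | true  | _ = x , ≤-pred lo<1+x , ≤-refl , Px , λ x<w w<1+x → contradiction (≤-pred w<1+x) (<⇒≱ x<w)
... | false | inj₂ refl = contradiction (trans (sym Plo) Px) λ ()
... | false | inj₁ lo<x with greatest-below P x lo<x Plo
...   | u , lo≤u , u<x , Pu , beyond-u = u , lo≤u , m≤n⇒m≤1+n u<x , Pu , beyond-u′
  where
  beyond-u′ : ∀ {w} → u < w → w < suc x → P w ≡ false
  beyond-u′ u<w w<1+x with m<1+n⇒m<n∨m≡n w<1+x
  ... | inj₁ w<x  = beyond-u u<w w<x
  ... | inj₂ refl = Px

Triple : Set
Triple = ℕ × ℕ × ℕ

TrianglesAt : ArcSet → ℕ → Pred Triple 0ℓ
TrianglesAt R v t = Triangle R t × HasVertex v t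

RightFan : ArcSet → ℕ → ℕ → Pred Triple 0ℓ
RightFan R y x (i , j , k) = Triangle R (i , j , k) × y ≤ i × k ≡ x

LeftFan : ArcSet → ℕ → ℕ → Pred Triple 0ℓ
LeftFan R y x (i , j , k) = Triangle R (i , j , k) × i ≡ y × k ≤ x

triangleCount⇒hasSize : ∀ {R v q} → TriangleCount R v q → HasSize (TrianglesAt R v) q
triangleCount⇒hasSize (ts , uts , len , sound , complete) =
  ts , uts , len , sound _ , λ { (tri , v∈t) → complete _ tri v∈t }

module Triangulation {R : ArcSet} (T : IsTriangulation R) where
  open IsTriangulation T

  no-crossing : ∀ {a b c d} → (a , b) ∈R R → (c , d) ∈R R → a < c → c < b → b < d → ⊥
  no-crossing ab cd a<c c<b b<d = noncrossing _ _ _ _ ab cd (inj₁ (a<c , c<b , b<d))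

  side-arc : ∀ a → (a , suc a) ∈R R
  side-arc a = maximal a (suc a) ≤-refl no-arc-crosses
    where
    no-arc-crosses : ∀ c d → (c , d) ∈R R → ¬ Cross a (suc a) c d
    no-arc-crosses c d _ (inj₁ (a<c , c<1+a , _)) = <⇒≱ a<c (≤-pred c<1+a)
    no-arc-crosses c d _ (inj₂ (_ , a<d , d<1+a)) = <⇒≱ a<d (≤-pred d<1+a)

  apex : ∀ {y x} → (y , x) ∈R R → suc y < x →
         ∃[ u ] (y < u × u < x × (y , u) ∈R R × (u , x) ∈R R)
  apex {y} {x} yx 1+y<x with greatest-below (R y) x 1+y<x (side-arc y)
  ... | u , y<u , u<x , yu , beyond-u = u , y<u , u<x , yu , maximal u x u<x no-arc-crosses
    where
    no-arc-crosses : ∀ c d → (c , d) ∈R R → ¬ Cross u x c d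
    no-arc-crosses c d cd (inj₁ (u<c , c<x , x<d)) = no-crossing yx cd (<-trans y<u u<c) c<x x<d
    no-arc-crosses c d cd (inj₂ (c<u , u<d , d<x)) with <-cmp c y
    ... | tri< c<y _ _  = no-crossing cd yx c<y (<-trans y<u u<d) d<x
    ... | tri≈ _ refl _ = contradiction (trans (sym cd) (beyond-u u<d d<x)) λ ()
    ... | tri> _ _ y<c  = no-crossing yu cd y<c c<u u<d

  module Apex {y u x} (y<u : y < u) (u<x : u < x)
              (yu : (y , u) ∈R R) (ux : (u , x) ∈R R) (yx : (y , x) ∈R R) where

    apex-triangle : Triangle R (y , u , x)
    apex-triangle = y<u , u<x , yu , ux , yx

    middle-vertex-u⇒apex : ∀ {i k} → Triangle R (i , u , k) → (y , u , x) ≡ (i , u , k)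
    middle-vertex-u⇒apex (i<u , u<k , iu , uk , ik) = cong₂ (λ a c → a , u , c)
      (≤-antisym (≮⇒≥ λ i<y → no-crossing iu yx i<y y<u u<x) (≮⇒≥ λ y<i → no-crossing yu ik y<i i<u u<k))
      (≤-antisym (≮⇒≥ λ k<x → no-crossing ik ux i<u u<k k<x) (≮⇒≥ λ x<k → no-crossing yx uk y<u u<x x<k))

    rightFan-starting-before-u⇒apex : ∀ {i j} → Triangle R (i , j , x) → y ≤ i → i < u → (y , u , x) ≡ (i , j , x)
    rightFan-starting-before-u⇒apex (i<j , j<x , ij , jx , ix) y≤i i<u = cong₂ (λ a b → a , b , x)
      (≤-antisym y≤i (≮⇒≥ λ y<i → no-crossing yu ix y<i i<u u<x))
      (≤-antisym (≮⇒≥ λ j<u → no-crossing yu jx (≤-<-trans y≤i i<j) j<u u<x) (≮⇒≥ λ u<j → no-crossing ij ux i<u u<j j<x))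

    leftFan-ending-after-u⇒apex : ∀ {j k} → Triangle R (y , j , k) → k ≤ x → u < k → (y , u , x) ≡ (y , j , k)
    leftFan-ending-after-u⇒apex (y<j , j<k , yj , jk , yk) k≤x u<k = cong₂ (λ b c → y , b , c)
      (≤-antisym (≮⇒≥ λ j<u → no-crossing yu jk y<j j<u u<k) (≮⇒≥ λ u<j → no-crossing yj ux y<u u<j (<-≤-trans j<k k≤x)))
      (≤-antisym (≮⇒≥ λ k<x → no-crossing yk ux y<u u<k k<x) k≤x)

    trianglesAt-apex : TrianglesAt R u ≐ (RightFan R y u ∪ ｛ y , u , x ｝ ∪ LeftFan R u x)
    trianglesAt-apex = split , join
      where
      split : ∀ {t} → TrianglesAt R u t → (RightFan R y u ∪ ｛ y , u , x ｝ ∪ LeftFan R u x) t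
      split (tri@(_ , _ , _ , _ , ik) , inj₁ refl)       = inj₂ (inj₂ (tri , refl , ≮⇒≥ λ x<k → no-crossing yx ik y<u u<x x<k))
      split (tri , inj₂ (inj₁ refl))                     = inj₂ (inj₁ (middle-vertex-u⇒apex tri))
      split (tri@(_ , _ , _ , _ , ik) , inj₂ (inj₂ refl)) = inj₁ (tri , ≮⇒≥ (λ i<y → no-crossing ik yx i<y y<u u<x) , refl)
      join : ∀ {t} → (RightFan R y u ∪ ｛ y , u , x ｝ ∪ LeftFan R u x) t → TrianglesAt R u t
      join (inj₁ (tri , _ , refl))        = tri , inj₂ (inj₂ refl)
      join (inj₂ (inj₁ refl))             = apex-triangle , inj₂ (inj₁ refl)
      join (inj₂ (inj₂ (tri , refl , _))) = tri , inj₁ refl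

    rightFan-split : RightFan R y x ≐ (｛ y , u , x ｝ ∪ RightFan R u x)
    rightFan-split = split , join
      where
      split : ∀ {t} → RightFan R y x t → (｛ y , u , x ｝ ∪ RightFan R u x) t
      split {i , j , k} (tri , y≤i , refl) with u ≤? i
      ... | yes u≤i = inj₂ (tri , u≤i , refl)
      ... | no u≰i  = inj₁ (rightFan-starting-before-u⇒apex tri y≤i (≰⇒> u≰i))
      join : ∀ {t} → (｛ y , u , x ｝ ∪ RightFan R u x) t → RightFan R y x t
      join (inj₁ refl)               = apex-triangle , ≤-refl , refl
      join (inj₂ (tri , u≤i , refl)) = tri , ≤-trans (<⇒≤ y<u) u≤i , refl

    leftFan-split : LeftFan R y x ≐ (｛ y , u , x ｝ ∪ LeftFan R y u)
    leftFan-split = split , join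
      where
      split : ∀ {t} → LeftFan R y x t → (｛ y , u , x ｝ ∪ LeftFan R y u) t
      split {i , j , k} (tri , refl , k≤x) with k ≤? u
      ... | yes k≤u = inj₂ (tri , refl , k≤u)
      ... | no k≰u  = inj₁ (leftFan-ending-after-u⇒apex tri k≤x (≰⇒> k≰u))
      join : ∀ {t} → (｛ y , u , x ｝ ∪ LeftFan R y u) t → LeftFan R y x t
      join (inj₁ refl)               = apex-triangle , refl , ≤-refl
      join (inj₂ (tri , refl , k≤u)) = tri , refl , ≤-trans k≤u (<⇒≤ u<x)

    trianglesAt-apex-size : ∀ {n k} → HasSize (RightFan R y u) n → HasSize (LeftFan R u x) k →
                            HasSize (TrianglesAt R u) (n + suc k)
    trianglesAt-apex-size right left = hasSize-resp-≐ (≐-sym trianglesAt-apex)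
      (hasSize-∪ right-disjoint right (hasSize-∪ apex-disjoint (hasSize-singleton _) left))
      where
      right-disjoint : ∀ {t} → RightFan R y u t → ¬ (｛ y , u , x ｝ ∪ LeftFan R u x) t
      right-disjoint (_ , _ , x≡u) (inj₁ refl)                        = <-irrefl (sym x≡u) u<x
      right-disjoint ((i<j , j<k , _) , _ , refl) (inj₂ (_ , refl , _)) = <-irrefl refl (<-trans i<j j<k)
      apex-disjoint : ∀ {t} → (y , u , x) ≡ t → ¬ LeftFan R u x t
      apex-disjoint refl (_ , y≡u , _) = <-irrefl y≡u y<u

    rightFan-size : ∀ {n} → HasSize (RightFan R u x) n → HasSize (RightFan R y x) (suc n)
    rightFan-size = hasSize-resp-≐ (≐-sym rightFan-split)
                  ∘ hasSize-∪ (λ { refl (_ , u≤y , _) → <⇒≱ y<u u≤y }) (hasSize-singleton _)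

    leftFan-size : ∀ {n} → HasSize (LeftFan R y u) n → HasSize (LeftFan R y x) (suc n)
    leftFan-size = hasSize-resp-≐ (≐-sym leftFan-split)
                 ∘ hasSize-∪ (λ { refl (_ , _ , x≤u) → <⇒≱ u<x x≤u }) (hasSize-singleton _)

module FriezeOfTriangulation {R : ArcSet} {m : ℕ → ℕ → ℕ} (T : IsTriangulation R) (H : IsHalfFriezeFrom R m) where
  open IsHalfFriezeFrom H
  open IsRightHalfFrieze frieze
  open Frieze frieze
  open Triangulation T
  open IsTriangulation T using (arcs)
  open ≡-Reasoning

  record ArcInvariant (y x : ℕ) : Set where
    field
      unit     : m y x ≡ 1
      rightFan : HasSize (RightFan R y x) (m y (pred x))
      leftFan  : HasSize (LeftFan R y x) (m (suc y) x)

  side-invariant : ∀ y → ArcInvariant y (suc y)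
  side-invariant y = record
    { unit     = diag1 y
    ; rightFan = subst (HasSize _) (sym (diag0 y))
                   (hasSize-empty λ { ((i<j , j<k , _) , y≤i , refl) → <⇒≱ (≤-<-trans y≤i i<j) (≤-pred j<k) })
    ; leftFan  = subst (HasSize _) (sym (diag0 (suc y)))
                   (hasSize-empty λ { ((i<j , j<k , _) , refl , k≤1+y) → <⇒≱ i<j (≤-pred (<-≤-trans j<k k≤1+y)) })
    }

  apex-invariant : ∀ {y u x} → y < u → u < x → (y , u) ∈R R → (u , x) ∈R R → (y , x) ∈R R →
                   ArcInvariant y u → ArcInvariant u x → ArcInvariant y x
  apex-invariant {y} {u@(suc u′)} {x@(suc x′)} y<u u<x yu ux yx yu-invariant ux-invariant = record
    { unit     = yx-unit
    ; rightFan = subst (HasSize _) (sym right-entry) (rightFan-size UX.rightFan)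
    ; leftFan  = subst (HasSize _) (sym left-entry) (leftFan-size YU.leftFan)
    }
    where
    open Apex y<u u<x yu ux yx
    module YU = ArcInvariant yu-invariant
    module UX = ArcInvariant ux-invariant

    quiddity-at-u : m u′ (suc u) ≡ m y u′ + suc (m (suc u) x)
    quiddity-at-u = hasSize-unique (triangleCount⇒hasSize (quiddity u′)) (trianglesAt-apex-size YU.rightFan UX.leftFan)

    entry-after-u : m y (suc u) ≡ suc (m (suc u) x)
    entry-after-u = +-cancelʳ-≡ (m y u′) _ _ (begin
      m y (suc u) + m y u′        ≡⟨ row-recurrence (≤-pred y<u) ⟩
      m u′ (suc u) * m y u        ≡⟨ cong (m u′ (suc u) *_) YU.unit ⟩
      m u′ (suc u) * 1            ≡⟨ *-identityʳ _ ⟩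
      m u′ (suc u)                ≡⟨ quiddity-at-u ⟩
      m y u′ + suc (m (suc u) x)  ≡⟨ +-comm (m y u′) _ ⟩
      suc (m (suc u) x) + m y u′  ∎)

    yx-unit : m y x ≡ 1
    yx-unit = +-cancelˡ-≡ (m (suc u) x) _ _ (begin
      m (suc u) x + m y x                ≡⟨ cong (m (suc u) x +_) (*-identityʳ (m y x)) ⟨
      m (suc u) x + m y x * 1            ≡⟨ cong (λ e → m (suc u) x + m y x * e) (diag1 u) ⟨
      m (suc u) x + m y x * m u (suc u)  ≡⟨ ptolemy-ac (<⇒≤ y<u) (n≤1+n u) u<x YU.unit UX.unit ⟨
      m y (suc u)                        ≡⟨ entry-after-u ⟩
      suc (m (suc u) x)                  ≡⟨ +-comm 1 _ ⟩
      m (suc u) x + 1                    ∎)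

    right-entry : m y x′ ≡ suc (m u x′)
    right-entry = begin
      m y x′                   ≡⟨ ptolemy-ac (<⇒≤ y<u) (≤-pred u<x) (n≤1+n x′) YU.unit UX.unit ⟩
      m x′ x + m y x * m u x′  ≡⟨ cong₂ (λ e f → e + f * m u x′) (diag1 x′) yx-unit ⟩
      1 + 1 * m u x′           ≡⟨ cong suc (*-identityˡ (m u x′)) ⟩
      suc (m u x′)             ∎

    left-entry : m (suc y) x ≡ suc (m (suc y) u)
    left-entry = begin
      m (suc y) x                        ≡⟨ ptolemy-bd (n≤1+n y) y<u (<⇒≤ u<x) YU.unit UX.unit ⟩
      m y (suc y) + m y x * m (suc y) u  ≡⟨ cong₂ (λ e f → e + f * m (suc y) u) (diag1 y) yx-unit ⟩
      1 + 1 * m (suc y) u                ≡⟨ cong suc (*-identityˡ (m (suc y) u)) ⟩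
      suc (m (suc y) u)                  ∎

  arc-invariant : ∀ {y x} → (y , x) ∈R R → ArcInvariant y x
  arc-invariant {y} {x} = bounded x (m≤m+n x y)
    where
    bounded : ∀ n {y x} → x ≤ n + y → (y , x) ∈R R → ArcInvariant y x
    bounded zero    x≤y     yx = contradiction x≤y (<⇒≱ (arcs _ _ yx))
    bounded (suc n) {y} {x} x≤1+n+y yx with m≤n⇒m<n∨m≡n (arcs y x yx)
    ... | inj₂ refl = side-invariant y
    ... | inj₁ 1+y<x with apex yx 1+y<x
    ...   | u , y<u , u<x , yu , ux = apex-invariant y<u u<x yu ux yx
      (bounded n (≤-pred (<-≤-trans u<x x≤1+n+y)) yu)
      (bounded n (≤-trans x≤1+n+y (≤-trans (≤-reflexive (sym (+-suc n y))) (+-monoʳ-≤ n y<u))) ux)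

  arc⇒unit : ∀ {a b} → (a , b) ∈R R → m a b ≡ 1
  arc⇒unit = ArcInvariant.unit ∘ arc-invariant

unit⇒arc : ∀ {R m} → IsTriangulation R → IsRightHalfFrieze m → (∀ {c d} → (c , d) ∈R R → m c d ≡ 1) →
           ∀ {a b} → a < b → m a b ≡ 1 → (a , b) ∈R R
unit⇒arc {R} {m} T F arc⇒unit {a} {b} a<b ab = IsTriangulation.maximal T a b a<b no-arc-crosses
  where
  open Frieze F using (crossing-diagonals)
  no-arc-crosses : ∀ c d → (c , d) ∈R R → ¬ Cross a b c d
  no-arc-crosses c d cd (inj₁ (a<c , c<b , b<d)) =
    <-irrefl (sym (cong₂ _*_ ab (arc⇒unit cd))) (crossing-diagonals a<c c<b b<d)
  no-arc-crosses c d cd (inj₂ (c<a , a<d , d<b)) =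
    <-irrefl (sym (cong₂ _*_ (arc⇒unit cd) ab)) (crossing-diagonals c<a a<d d<b)

xFrieze≡xArc : ∀ R m n → (R 0 (suc n) ≡ true → m 0 (suc n) ≡ 1) →
               (m 0 (suc n) ≡ 1 → R 0 (suc n) ≡ true) → xFrieze m n ≡ xArc R n
xFrieze≡xArc R m n arc⇒unit unit⇒arc with R 0 (suc n) | m 0 (suc n)
... | true  | 1           = refl
... | true  | 0           = contradiction (arc⇒unit refl) λ ()
... | true  | suc (suc _) = contradiction (arc⇒unit refl) λ ()
... | false | 1           = contradiction (unit⇒arc refl) λ ()
... | false | 0           = refl
... | false | suc (suc _) = refl

-- Neither the fountain condition nor 1 ≤ n is needed: arcs and entries 1 correspond for every triangulation.
proposition3p24 : (R : ArcSet) → IsRightFountain0 R →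
                  (m : ℕ → ℕ → ℕ) → IsHalfFriezeFrom R m →
                  ∀ n → 1 ≤ n → xFrieze m n ≡ xArc R n
proposition3p24 R fountain m H n _ =
  xFrieze≡xArc R m n arc⇒unit (unit⇒arc triangulation frieze arc⇒unit z<s)
  where
  open IsRightFountain0 fountain using (triangulation)
  open IsHalfFriezeFrom H using (frieze)
  open FriezeOfTriangulation triangulation H using (arc⇒unit)
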